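{- Let $T$ be a decomposable tournament and $D$ a co-modular decomposition of $T$. (1) $T$ has at most two singletons that are co-modules of $T$; in particular $D$ contains at most two singletons. (2) If $D$ contains an element $M$ that is not a module of $T$, then every element of $D\setminus\{M\}$ is a nontrivial module of $T$. (3) If $D$ is a $\Delta$-decomposition of $T$, then $\bigcup D$ is not contained in any co-module of $T$. (4) If $D$ is a $\Delta$-decomposition of $T$ and $|V(T)| \geq 4$, then $D$ contains a nontrivial module of $T$.
   Context: A tournament $T$ is a finite vertex set $V(T)$ with an arc set $A(T)$ such that for all distinct $x,y$, exactly one of $(x,y),(y,x)$ lies in $A(T)$. A module of $T$ is a subset $M \subseteq V(T)$ such that for all $x,y \in M$ and $v \notin M$, $(v,x)\in A(T)$ iff $(v,y)\in A(T)$; trivial modules are $\emptyset$, singletons and $V(T)$; $T$ is decomposable if it has a nontrivial module. With $\overline{X} = V(T)\setminus X$, a co-module of $T$ is a set $M$ such that $M$ or $\overline{M}$ is a nontrivial module; a co-modular decomposition is a set of pairwise disjoint co-modules; $\Delta(T)$ is the largest size of a co-modular decomposition; a $\Delta$-decomposition is a co-modular decomposition of size $\Delta(T)$. -}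

module Defs where

open import Data.Nat using (ℕ; _≤_)
open import Data.Bool using (Bool; true; false; not)
open import Data.Fin using (Fin)
open import Data.Fin.Subset using (Subset; _∈_; _∉_; ⊥; ⊤; ⁅_⁆; ∁; _∩_)
open import Data.List using (List; length)
open import Data.List.Relation.Unary.AllPairs using (AllPairs)
open import Data.List.Relation.Unary.All using (All)
open import Data.Product using (Σ; ∃; _×_)
open import Data.Sum using (_⊎_)
open import Function.Bundles using (_⇔_)
open import Relation.Binary.PropositionalEquality using (_≡_; _≢_)
open import Relation.Nullary using (¬_)

-- A tournament on the vertex set Fin n: arc x y ≡ true means (x,y) ∈ A(T).
record Tournament (n : ℕ) : Set where
  field
    arc    : Fin n → Fin n → Bool
    irrefl : ∀ x → arc x x ≡ false
    tourn  : ∀ x y → x ≢ y → arc y x ≡ not (arc x y)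
open Tournament public

Arc : ∀ {n} → Tournament n → Fin n → Fin n → Set
Arc T x y = arc T x y ≡ true

IsModule : ∀ {n} → Tournament n → Subset n → Set
IsModule T M = ∀ x y v → x ∈ M → y ∈ M → v ∉ M → (Arc T v x ⇔ Arc T v y)

IsTrivial : ∀ {n} → Subset n → Set
IsTrivial M = (M ≡ ⊥) ⊎ (∃ λ x → M ≡ ⁅ x ⁆) ⊎ (M ≡ ⊤)

IsNontrivialModule : ∀ {n} → Tournament n → Subset n → Set
IsNontrivialModule T M = IsModule T M × ¬ IsTrivial M

Decomposable : ∀ {n} → Tournament n → Set
Decomposable T = ∃ λ M → IsNontrivialModule T M

IsCoModule : ∀ {n} → Tournament n → Subset n → Set
IsCoModule T M = IsNontrivialModule T M ⊎ IsNontrivialModule T (∁ M)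

Disjoint : ∀ {n} → Subset n → Subset n → Set
Disjoint M N = M ∩ N ≡ ⊥

-- A co-modular decomposition, given as a list of pairwise disjoint co-modules.
-- (Co-modules are nonempty, so pairwise disjoint entries are pairwise distinct
-- and the list length is the cardinality of the set.)
IsCoModDec : ∀ {n} → Tournament n → List (Subset n) → Set
IsCoModDec T D = All (IsCoModule T) D × AllPairs Disjoint D

IsΔDecomposition : ∀ {n} → Tournament n → List (Subset n) → Set
IsΔDecomposition T D =
  IsCoModDec T D × (∀ D' → IsCoModDec T D' → length D' ≤ length D)

module Submission where

-- Everything rests on one transfer principle (disjoint-co-modules): if the
-- complements of two disjoint sets M and N are modules and M is nonempty,
-- then N itself is a module.  For a,b ∈ N and v ∉ N, pick m ∈ M; the arc
-- between v and a agrees with the one between m and a (since ∁N is a module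
-- containing v and m), the arcs from m to a and to b agree (since ∁M is a
-- module containing a and b), and symmetrically back to v and b.

open import Defs
open import Data.Nat using (ℕ; _≤_; _<_; s≤s; z≤n)
open import Data.Nat.Properties using (≤-refl; <-irrefl; <⇒≱)
open import Data.Fin using (Fin; _≟_)
open import Data.Fin.Properties using (any?; ¬∀⟶∃¬; injective⇒≤)
open import Data.Fin.Subset
  using (Subset; _⊆_; ⁅_⁆; ⋃; ∁; _∩_; Nonempty)
  renaming (_∈_ to _∈ˢ_; _∉_ to _∉ˢ_; ⊥ to ∅; ⊤ to 𝕍)
open import Data.Fin.Subset.Properties
  using ( ∉⊥; ∈⊤; x∈⁅x⁆; x∈⁅y⁆⇒x≡y; ⊆-antisym; x∈p⇒x∉∁p; x∈∁p⇒x∉p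
        ; x∉∁p⇒x∈p; x∉p⇒x∈∁p; x∈p∩q⁺; x∈p∩q⁻; x∈p∪q⁺; p∪∁p≡⊤; ∪-identityˡ
        ; nonempty?; Empty-unique) renaming (_∈?_ to _∈ˢ?_)
open import Data.Vec.Properties using (≡-dec)
open import Data.Bool using (true; false; not)
open import Data.Bool.Properties using (not-¬) renaming (_≟_ to _≟ᵇ_)
open import Data.List using (List; []; _∷_; length)
open import Data.List.Membership.Propositional using (_∈_)
import Data.List.Membership.DecPropositional as DecMembership
open import Data.List.Membership.Setoid.Properties using (index-injective)
open import Data.List.Relation.Unary.Any using (here; there; index)
open import Data.List.Relation.Unary.All using (All; []; _∷_)
import Data.List.Relation.Unary.All as All
open import Data.List.Relation.Unary.AllPairs using (AllPairs; []; _∷_)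
open import Data.List.Relation.Unary.Unique.Propositional using (Unique)
open import Data.Product using (∃; _×_; _,_; proj₁; proj₂)
open import Data.Sum using (_⊎_; inj₁; inj₂)
open import Data.Empty using (⊥; ⊥-elim)
open import Function.Bundles using (_⇔_; mk⇔; Equivalence)
open import Relation.Nullary using (¬_; Dec; yes; no)
open import Relation.Binary.PropositionalEquality
  using (_≡_; _≢_; refl; sym; trans; cong; subst; setoid; module ≡-Reasoning)

∁-involutive : ∀ {n} (p : Subset n) → ∁ (∁ p) ≡ p
∁-involutive p =
  ⊆-antisym (λ h → x∉∁p⇒x∈p (x∈∁p⇒x∉p h)) (λ h → x∉p⇒x∈∁p (x∈p⇒x∉∁p h))

∁∅≡𝕍 : ∀ {n} → ∁ (∅ {n}) ≡ 𝕍
∁∅≡𝕍 = trans (sym (∪-identityˡ (∁ ∅))) (p∪∁p≡⊤ ∅)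

nonempty-if-∁≢𝕍 : ∀ {n} {M : Subset n} → ∁ M ≢ 𝕍 → Nonempty M
nonempty-if-∁≢𝕍 {M = M} ∁M≢𝕍 with nonempty? M
... | yes ne = ne
... | no empty = ⊥-elim (∁M≢𝕍 (trans (cong ∁ (Empty-unique empty)) ∁∅≡𝕍))

disjoint⁺ : ∀ {n} {M N : Subset n} → (∀ {x} → x ∈ˢ M → x ∉ˢ N) → Disjoint M N
disjoint⁺ {M = M} {N} apart =
  ⊆-antisym (λ h → let (xM , xN) = x∈p∩q⁻ M N h in ⊥-elim (apart xM xN))
            (λ h → ⊥-elim (∉⊥ h))

disjoint⁻ : ∀ {n} {M N : Subset n} {x} → Disjoint M N → x ∈ˢ M → x ∉ˢ N
disjoint⁻ {x = x} d xM xN = ∉⊥ (subst (x ∈ˢ_) d (x∈p∩q⁺ (xM , xN)))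

disjoint-sym : ∀ {n} {M N : Subset n} → Disjoint M N → Disjoint N M
disjoint-sym d = disjoint⁺ (λ xN xM → disjoint⁻ d xM xN)

disjoint-in : ∀ {n} {D : List (Subset n)} {M N} →
  AllPairs Disjoint D →
  M ∈ D → N ∈ D → N ≢ M → Disjoint M N
disjoint-in (_  ∷ _)  (here refl) (here refl) N≢M = ⊥-elim (N≢M refl)
disjoint-in (dM ∷ _)  (here refl) (there N∈) _   = All.lookup dM N∈
disjoint-in (dN ∷ _)  (there M∈) (here refl) _   = disjoint-sym (All.lookup dN M∈)
disjoint-in (_  ∷ ds) (there M∈) (there N∈) N≢M = disjoint-in ds M∈ N∈ N≢M

∈-⋃ : ∀ {n} {D : List (Subset n)} {M x} → M ∈ D → x ∈ˢ M → x ∈ˢ ⋃ D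
∈-⋃ (here refl) xM = x∈p∪q⁺ (inj₁ xM)
∈-⋃ (there M∈) xM = x∈p∪q⁺ (inj₂ (∈-⋃ M∈ xM))

IsSingleton : ∀ {n} → Subset n → Set
IsSingleton M = ∃ λ x → M ≡ ⁅ x ⁆

singleton? : ∀ {n} (M : Subset n) → Dec (IsSingleton M)
singleton? M = any? (λ x → ≡-dec _≟ᵇ_ M ⁅ x ⁆)

-- A list of fewer than n points of Fin n misses some point: otherwise the
-- position of each point in the list would inject Fin n into Fin (length xs).
missing-point : ∀ {n} (xs : List (Fin n)) → length xs < n → ∃ λ e → ¬ e ∈ xs
missing-point {n} xs short = ¬∀⟶∃¬ n (_∈ xs) (_∈? xs) covering-impossible
  where
  open DecMembership (_≟_ {n}) using (_∈?_)
  covering-impossible : ¬ (∀ e → e ∈ xs)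
  covering-impossible covered =
    <⇒≱ short (injective⇒≤ {f = λ e → index (covered e)}
                 (index-injective (setoid (Fin n)) (covered _) (covered _)))

module _ {n : ℕ} (T : Tournament n) where

  module⇒arc≡ : ∀ {C : Subset n} {x y v} → IsModule T C →
    x ∈ˢ C → y ∈ˢ C → v ∉ˢ C → arc T v x ≡ arc T v y
  module⇒arc≡ {x = x} {y} {v} mod xC yC vC with arc T v x | arc T v y | mod x y v xC yC vC
  ... | false | false | _ = refl
  ... | true  | true  | _ = refl
  ... | false | true  | iff = Equivalence.from iff refl
  ... | true  | false | iff = sym (Equivalence.to iff refl)

  arc≡⇒module : ∀ {C : Subset n} →
    (∀ {x y v} → x ∈ˢ C → y ∈ˢ C → v ∉ˢ C → arc T v x ≡ arc T v y) → IsModule T C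
  arc≡⇒module same x y v xC yC vC =
    mk⇔ (λ h → trans (sym (same xC yC vC)) h) (λ h → trans (same xC yC vC) h)

  ∩-module : ∀ {A B : Subset n} → IsModule T A → IsModule T B → IsModule T (A ∩ B)
  ∩-module {A} {B} modA modB x y v xAB yAB vAB =
    case (x∈p∩q⁻ A B xAB) (x∈p∩q⁻ A B yAB)
    where
    case : x ∈ˢ A × x ∈ˢ B → y ∈ˢ A × y ∈ˢ B → (Arc T v x ⇔ Arc T v y)
    case (xA , xB) (yA , yB) with v ∈ˢ? A
    ... | no vA = modA x y v xA yA vA
    ... | yes vA = modB x y v xB yB (λ vB → vAB (x∈p∩q⁺ (vA , vB)))

  disjoint-co-modules : ∀ {M N : Subset n} → IsModule T (∁ M) → IsModule T (∁ N) →
    Disjoint M N → Nonempty M → IsModule T N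
  disjoint-co-modules {M} {N} mod∁M mod∁N d (m , mM) = arc≡⇒module same
    where
    m∉N : m ∉ˢ N
    m∉N = disjoint⁻ d mM
    outside-M : ∀ {a} → a ∈ˢ N → a ∈ˢ ∁ M
    outside-M aN = x∉p⇒x∈∁p (λ aM → disjoint⁻ d aM aN)
    apart : ∀ {a b} → a ∈ˢ N → b ∉ˢ N → a ≢ b
    apart aN bN refl = bN aN
    via-m : ∀ {a v} → a ∈ˢ N → v ∉ˢ N → arc T a v ≡ arc T a m
    via-m aN vN = module⇒arc≡ mod∁N (x∉p⇒x∈∁p vN) (x∉p⇒x∈∁p m∉N) (x∈p⇒x∉∁p aN)
    same : ∀ {a b v} → a ∈ˢ N → b ∈ˢ N → v ∉ˢ N → arc T v a ≡ arc T v b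
    same {a} {b} {v} aN bN vN = begin
      arc T v a        ≡⟨ tourn T a v (apart aN vN) ⟩
      not (arc T a v)  ≡⟨ cong not (via-m aN vN) ⟩
      not (arc T a m)  ≡⟨ sym (tourn T a m (apart aN m∉N)) ⟩
      arc T m a        ≡⟨ module⇒arc≡ mod∁M (outside-M aN) (outside-M bN) (x∈p⇒x∉∁p mM) ⟩
      arc T m b        ≡⟨ tourn T b m (apart bN m∉N) ⟩
      not (arc T b m)  ≡⟨ cong not (sym (via-m bN vN)) ⟩
      not (arc T b v)  ≡⟨ sym (tourn T b v (apart bN vN)) ⟩
      arc T v b        ∎
      where open ≡-Reasoning

  -- No three distinct vertices all have a module as complement: the three
  -- module conditions force a cyclic pattern contradicting antisymmetry.
  no-three-singletons : ∀ {x y z : Fin n} → x ≢ y → x ≢ z → y ≢ z →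
    IsModule T (∁ ⁅ x ⁆) → IsModule T (∁ ⁅ y ⁆) → IsModule T (∁ ⁅ z ⁆) → ⊥
  no-three-singletons {x} {y} {z} x≢y x≢z y≢z mod-x mod-y mod-z =
    not-¬ refl cycle
    where
    in∁ : ∀ {a b} → a ≢ b → a ∈ˢ ∁ ⁅ b ⁆
    in∁ a≢b = x∉p⇒x∈∁p (λ h → a≢b (x∈⁅y⁆⇒x≡y _ h))
    out∁ : ∀ a → a ∉ˢ ∁ ⁅ a ⁆
    out∁ a = x∈p⇒x∉∁p (x∈⁅x⁆ a)
    cycle : arc T x y ≡ not (arc T x y)
    cycle = begin
      arc T x y        ≡⟨ module⇒arc≡ mod-x (in∁ (λ e → x≢y (sym e))) (in∁ (λ e → x≢z (sym e))) (out∁ x) ⟩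
      arc T x z        ≡⟨ tourn T z x (λ e → x≢z (sym e)) ⟩
      not (arc T z x)  ≡⟨ cong not (module⇒arc≡ mod-z (in∁ x≢z) (in∁ y≢z) (out∁ z)) ⟩
      not (arc T z y)  ≡⟨ sym (tourn T z y (λ e → y≢z (sym e))) ⟩
      arc T y z        ≡⟨ module⇒arc≡ mod-y (in∁ (λ e → y≢z (sym e))) (in∁ x≢y) (out∁ y) ⟩
      arc T y x        ≡⟨ tourn T x y x≢y ⟩
      not (arc T x y)  ∎
      where open ≡-Reasoning

  co-module-∁ : ∀ {C : Subset n} → IsCoModule T C → IsCoModule T (∁ C)
  co-module-∁ {C} (inj₁ ntC) = inj₂ (subst (IsNontrivialModule T) (sym (∁-involutive C)) ntC)
  co-module-∁ (inj₂ nt∁C) = inj₁ nt∁C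

  singleton-trivial : ∀ {x : Fin n} → ¬ IsNontrivialModule T ⁅ x ⁆
  singleton-trivial {x} (_ , nontrivial) = nontrivial (inj₂ (inj₁ (x , refl)))

  singleton-co-module : ∀ {x : Fin n} → IsCoModule T ⁅ x ⁆ → IsModule T (∁ ⁅ x ⁆)
  singleton-co-module (inj₁ nt) = ⊥-elim (singleton-trivial nt)
  singleton-co-module (inj₂ (mod , _)) = mod

  nonempty-if-∁-nontrivial : ∀ {M : Subset n} → IsNontrivialModule T (∁ M) → Nonempty M
  nonempty-if-∁-nontrivial (_ , nontrivial) = nonempty-if-∁≢𝕍 (λ e → nontrivial (inj₂ (inj₂ e)))

  beside-co-module : ∀ {M N : Subset n} → IsNontrivialModule T (∁ M) → IsNontrivialModule T (∁ N) →
    Disjoint M N → ¬ IsSingleton N → IsNontrivialModule T N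
  beside-co-module {M} {N} nt∁M (mod∁N , nontrivial∁N) d N-not-singleton =
    disjoint-co-modules (proj₁ nt∁M) mod∁N d (m , mM) , nontrivial
    where
    m : Fin n
    m = proj₁ (nonempty-if-∁-nontrivial nt∁M)
    mM : m ∈ˢ M
    mM = proj₂ (nonempty-if-∁-nontrivial nt∁M)
    nontrivial : ¬ IsTrivial N
    nontrivial (inj₁ N≡∅) = nontrivial∁N (inj₂ (inj₂ (trans (cong ∁ N≡∅) ∁∅≡𝕍)))
    nontrivial (inj₂ (inj₁ singleton)) = N-not-singleton singleton
    nontrivial (inj₂ (inj₂ N≡𝕍)) = disjoint⁻ d mM (subst (m ∈ˢ_) (sym N≡𝕍) ∈⊤)

  pair-of-co-modules : ∀ {M N : Subset n} → IsNontrivialModule T (∁ M) → IsNontrivialModule T (∁ N) →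
    Disjoint M N → IsNontrivialModule T M ⊎ IsNontrivialModule T N ⊎ (IsSingleton M × IsSingleton N)
  pair-of-co-modules {M} {N} nt∁M nt∁N d with singleton? N | singleton? M
  ... | no N-not-singleton | _ = inj₂ (inj₁ (beside-co-module nt∁M nt∁N d N-not-singleton))
  ... | yes _ | no M-not-singleton =
    inj₁ (beside-co-module nt∁N nt∁M (disjoint-sym d) M-not-singleton)
  ... | yes sN | yes sM = inj₂ (inj₂ (sM , sN))

  three-blocks : ∀ {M N : Subset n} → IsCoModule T M → IsCoModule T N →
    IsModule T (∁ M) → IsModule T (∁ N) → Disjoint M N → ¬ IsTrivial (∁ M ∩ ∁ N) →
    IsCoModDec T (M ∷ N ∷ (∁ M ∩ ∁ N) ∷ [])
  three-blocks {M} {N} cM cN mod∁M mod∁N d nontrivial =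
    (cM ∷ cN ∷ inj₁ (∩-module mod∁M mod∁N , nontrivial) ∷ []) ,
    ((d ∷ disjoint⁺ outside-M ∷ []) ∷ (disjoint⁺ outside-N ∷ []) ∷ [] ∷ [])
    where
    outside-M : ∀ {x} → x ∈ˢ M → x ∉ˢ ∁ M ∩ ∁ N
    outside-M xM h = x∈∁p⇒x∉p (proj₁ (x∈p∩q⁻ (∁ M) (∁ N) h)) xM
    outside-N : ∀ {x} → x ∈ˢ N → x ∉ˢ ∁ M ∩ ∁ N
    outside-N xN h = x∈∁p⇒x∉p (proj₂ (x∈p∩q⁻ (∁ M) (∁ N) h)) xN

  two-removed-nontrivial : 4 ≤ n → (x y : Fin n) → ¬ IsTrivial (∁ ⁅ x ⁆ ∩ ∁ ⁅ y ⁆)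
  two-removed-nontrivial four x y = nontrivial
    where
    W = ∁ ⁅ x ⁆ ∩ ∁ ⁅ y ⁆
    in-W : ∀ {e} z → ¬ e ∈ (x ∷ y ∷ z ∷ []) → e ∈ˢ W
    in-W z e∉ = x∈p∩q⁺ (x∉p⇒x∈∁p (λ h → e∉ (here (x∈⁅y⁆⇒x≡y x h))) ,
                        x∉p⇒x∈∁p (λ h → e∉ (there (here (x∈⁅y⁆⇒x≡y y h)))))
    nontrivial : ¬ IsTrivial W
    nontrivial (inj₁ W≡∅) =
      let (e , e∉) = missing-point (x ∷ y ∷ x ∷ []) four
      in ∉⊥ (subst (e ∈ˢ_) W≡∅ (in-W x e∉))
    nontrivial (inj₂ (inj₁ (z , W≡z))) =
      let (e , e∉) = missing-point (x ∷ y ∷ z ∷ []) four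
      in e∉ (there (there (here (x∈⁅y⁆⇒x≡y z (subst (e ∈ˢ_) W≡z (in-W z e∉))))))
    nontrivial (inj₂ (inj₂ W≡𝕍)) =
      x∈∁p⇒x∉p (proj₁ (x∈p∩q⁻ (∁ ⁅ x ⁆) (∁ ⁅ y ⁆) (subst (x ∈ˢ_) (sym W≡𝕍) ∈⊤))) (x∈⁅x⁆ x)

  singletons-distinct : ∀ {x y : Fin n} → Disjoint ⁅ x ⁆ ⁅ y ⁆ → x ≢ y
  singletons-distinct {x} d refl = disjoint⁻ d (x∈⁅x⁆ x) (x∈⁅x⁆ x)

  at-most-two-singleton-co-modules : ∀ (xs : List (Fin n)) → Unique xs →
    All (λ x → IsCoModule T ⁅ x ⁆) xs → length xs ≤ 2
  at-most-two-singleton-co-modules [] _ _ = z≤n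
  at-most-two-singleton-co-modules (_ ∷ []) _ _ = s≤s z≤n
  at-most-two-singleton-co-modules (_ ∷ _ ∷ []) _ _ = s≤s (s≤s z≤n)
  at-most-two-singleton-co-modules (x ∷ y ∷ z ∷ _) ((x≢y ∷ x≢z ∷ _) ∷ (y≢z ∷ _) ∷ _) (cx ∷ cy ∷ cz ∷ _) =
    ⊥-elim (no-three-singletons x≢y x≢z y≢z
              (singleton-co-module cx) (singleton-co-module cy) (singleton-co-module cz))

  -- Part (2): a co-module disjoint from a co-module that is not a module is a
  -- nontrivial module, since otherwise the transfer principle would make the
  -- latter a module.
  beside-non-module : ∀ {M N : Subset n} → IsCoModule T M → ¬ IsModule T M →
    IsCoModule T N → Disjoint M N → IsNontrivialModule T N
  beside-non-module (inj₁ ntM) not-module _ _ = ⊥-elim (not-module (proj₁ ntM))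
  beside-non-module _ _ (inj₁ ntN) _ = ntN
  beside-non-module (inj₂ nt∁M) not-module (inj₂ nt∁N) d =
    ⊥-elim (not-module (disjoint-co-modules (proj₁ nt∁N) (proj₁ nt∁M) (disjoint-sym d)
                          (nonempty-if-∁-nontrivial nt∁N)))

  -- Part (3): otherwise the complement of the co-module could be added to D.
  Δ-not-inside-co-module : ∀ {D : List (Subset n)} → IsΔDecomposition T D →
    ∀ C → IsCoModule T C → ¬ (⋃ D ⊆ C)
  Δ-not-inside-co-module {D} ((cD , dD) , maximal) C cC ⋃D⊆C =
    <-irrefl refl (maximal (∁ C ∷ D) ((co-module-∁ cC ∷ cD) , (apart ∷ dD)))
    where
    apart : All (Disjoint (∁ C)) D
    apart = All.tabulate (λ M∈D → disjoint⁺ (λ x∁C xM → x∈∁p⇒x∉p x∁C (⋃D⊆C (∈-⋃ M∈D xM))))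

  -- A nontrivial module K and its complement form a co-modular decomposition,
  -- so a Δ-decomposition of a decomposable tournament has two blocks.
  Δ-has-two-blocks : ∀ {D : List (Subset n)} → Decomposable T → IsΔDecomposition T D → 2 ≤ length D
  Δ-has-two-blocks (K , ntK) (_ , maximal) =
    maximal (K ∷ ∁ K ∷ [])
      ((inj₁ ntK ∷ co-module-∁ (inj₁ ntK) ∷ []) ,
       ((disjoint⁺ (λ xK x∁K → x∈∁p⇒x∉p x∁K xK) ∷ []) ∷ [] ∷ []))

  -- In a maximum decomposition starting with two singletons {x}, {y} whose
  -- complements are nontrivial modules, some later block is a nontrivial
  -- module: a third block that is not would be a third such singleton, and
  -- without a third block {x}, {y}, ∁{x} ∩ ∁{y} would be a larger decomposition.
  after-two-singletons : ∀ {x y : Fin n} (rest : List (Subset n)) →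
    IsNontrivialModule T (∁ ⁅ x ⁆) → IsNontrivialModule T (∁ ⁅ y ⁆) → Disjoint ⁅ x ⁆ ⁅ y ⁆ →
    All (IsCoModule T) rest → All (Disjoint ⁅ x ⁆) rest → All (Disjoint ⁅ y ⁆) rest →
    (∀ D' → IsCoModDec T D' → length D' ≤ length (⁅ x ⁆ ∷ ⁅ y ⁆ ∷ rest)) → 4 ≤ n →
    ∃ λ L → L ∈ rest × IsNontrivialModule T L
  after-two-singletons {x} {y} [] nt∁x nt∁y dxy _ _ _ maximal four =
    ⊥-elim (<⇒≱ ≤-refl (maximal _ (three-blocks (inj₂ nt∁x) (inj₂ nt∁y) (proj₁ nt∁x) (proj₁ nt∁y) dxy
                                     (two-removed-nontrivial four x y))))
  after-two-singletons (L ∷ _) nt∁x nt∁y dxy (cL ∷ _) (dxL ∷ _) (dyL ∷ _) _ _ with cL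
  ... | inj₁ ntL = L , here refl , ntL
  ... | inj₂ nt∁L with pair-of-co-modules nt∁x nt∁L dxL
  ...   | inj₁ nt-x = ⊥-elim (singleton-trivial nt-x)
  ...   | inj₂ (inj₁ ntL) = L , here refl , ntL
  ...   | inj₂ (inj₂ (_ , (z , refl))) =
    ⊥-elim (no-three-singletons (singletons-distinct dxy) (singletons-distinct dxL) (singletons-distinct dyL)
              (proj₁ nt∁x) (proj₁ nt∁y) (proj₁ nt∁L))

  -- Part (4): the first two blocks are nontrivial modules, or are two
  -- singletons and the previous lemma applies.
  Δ-contains-nontrivial-module : ∀ {D : List (Subset n)} → Decomposable T → IsΔDecomposition T D →
    4 ≤ n → ∃ λ M → M ∈ D × IsNontrivialModule T M
  Δ-contains-nontrivial-module {D} dec Δ four = first-two D Δ (Δ-has-two-blocks dec Δ)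
    where
    first-two : ∀ E → IsΔDecomposition T E → 2 ≤ length E → ∃ λ M → M ∈ E × IsNontrivialModule T M
    first-two [] _ ()
    first-two (_ ∷ []) _ (s≤s ())
    first-two (M ∷ N ∷ rest) (((cM ∷ cN ∷ cR) , ((dMN ∷ dMR) ∷ dNR ∷ _)) , maximal) _ with cM | cN
    ... | inj₁ ntM | _ = M , here refl , ntM
    ... | inj₂ _ | inj₁ ntN = N , there (here refl) , ntN
    ... | inj₂ nt∁M | inj₂ nt∁N with pair-of-co-modules nt∁M nt∁N dMN
    ...   | inj₁ ntM = M , here refl , ntM
    ...   | inj₂ (inj₁ ntN) = N , there (here refl) , ntN
    ...   | inj₂ (inj₂ ((x , refl) , (y , refl))) =
      let (L , L∈ , ntL) = after-two-singletons rest nt∁M nt∁N dMN cR dMR dNR maximal four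
      in L , there (there L∈) , ntL

lemma2 : ∀ {n : ℕ} (T : Tournament n) (D : List (Subset n)) →
    Decomposable T → IsCoModDec T D →
    ((∀ (xs : List (Fin n)) → Unique xs → All (λ x → IsCoModule T ⁅ x ⁆) xs → length xs ≤ 2)
     × (∀ (xs : List (Fin n)) → Unique xs → All (λ x → ⁅ x ⁆ ∈ D) xs → length xs ≤ 2))
    × (∀ M → M ∈ D → ¬ IsModule T M → ∀ N → N ∈ D → N ≢ M → IsNontrivialModule T N)
    × (IsΔDecomposition T D → ∀ C → IsCoModule T C → ¬ (⋃ D ⊆ C))
    × (IsΔDecomposition T D → 4 ≤ n → ∃ λ M → M ∈ D × IsNontrivialModule T M)
lemma2 T D dec (cD , dD) =
  (at-most-two-singleton-co-modules T ,
   (λ xs unique in-D → at-most-two-singleton-co-modules T xs unique (All.map (All.lookup cD) in-D))) ,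
  (λ M M∈D not-module N N∈D N≢M →
     beside-non-module T (All.lookup cD M∈D) not-module (All.lookup cD N∈D) (disjoint-in dD M∈D N∈D N≢M)) ,
  Δ-not-inside-co-module T ,
  (λ Δ → Δ-contains-nontrivial-module T dec Δ)
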